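{- Let $t$ and $n$ be positive integers with $n \geq 2t$. If $\mathcal{A} \subset S_n$ is $t$-set-intersecting, $|\mathcal{A}| = t!(n-t)!$, and $\mathcal{A}$ is a disjoint union of $t$-cosets of $S_n$, then $\mathcal{A}$ is a coset of the stabilizer of a $t$-set, i.e. $\mathcal{A} = \{\sigma \in S_n : \sigma(x) = y\}$ for some $t$-element subsets $x, y \subset [n]$.
   Context: A family $\mathcal{A} \subset S_n$ is $t$-set-intersecting if for any $\sigma,\pi \in \mathcal{A}$ there is a $t$-element subset $x \subset [n]$ with $\sigma(x) = \pi(x)$. A $t$-coset of $S_n$ is a set of the form $T_{a\mapsto b} = \{\sigma \in S_n : \sigma(a_i) = b_i \text{ for } i=1,\ldots,t\}$, where $a=(a_1,\ldots,a_t)$ and $b=(b_1,\ldots,b_t)$ are $t$-tuples of distinct elements of $[n]$. -}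

module Defs where

open import Data.Nat using (ℕ; _*_; _∸_; _≤_; _!)
open import Data.Fin using (Fin)
open import Data.Fin.Subset using (Subset; ∣_∣)
open import Data.Fin.Permutation using (Permutation′; _⟨$⟩ʳ_; _⟨$⟩ˡ_)
open import Data.Vec using (tabulate; lookup)
open import Data.List using (List; length)
open import Data.List.Relation.Unary.Any using (Any)
open import Data.List.Relation.Unary.AllPairs using (AllPairs)
open import Data.Product using (Σ; ∃; ∃-syntax; _×_)
open import Function.Definitions using (Injective)
open import Function.Bundles using (_⇔_)
open import Relation.Binary.PropositionalEquality using (_≡_)
open import Relation.Nullary using (¬_)

Perm : ℕ → Set
Perm n = Permutation′ n

_≈ₚ_ : ∀ {n} → Perm n → Perm n → Set
σ ≈ₚ π = ∀ i → σ ⟨$⟩ʳ i ≡ π ⟨$⟩ʳ i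

-- image σ(x) of a subset x ⊆ [n]:  j ∈ σ(x)  iff  σ⁻¹(j) ∈ x
image : ∀ {n} → Perm n → Subset n → Subset n
image σ x = tabulate (λ j → lookup x (σ ⟨$⟩ˡ j))

-- a finite family 𝒜 ⊆ S_n, given as a duplicate-free list
Family : ℕ → Set
Family n = List (Perm n)

_∈𝒜_ : ∀ {n} → Perm n → Family n → Set
σ ∈𝒜 𝒜 = Any (σ ≈ₚ_) 𝒜

Distinct : ∀ {n} → Family n → Set
Distinct 𝒜 = AllPairs (λ σ π → ¬ (σ ≈ₚ π)) 𝒜

-- cardinality |𝒜| (valid since 𝒜 is duplicate-free)
size : ∀ {n} → Family n → ℕ
size 𝒜 = length 𝒜

SetIntersecting : ∀ {n} → ℕ → Family n → Set
SetIntersecting {n} t 𝒜 =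
  ∀ σ π → σ ∈𝒜 𝒜 → π ∈𝒜 𝒜 → ∃[ x ] (∣ x ∣ ≡ t × image σ x ≡ image π x)

record Coset (n t : ℕ) : Set where
  constructor mkCoset
  field
    a : Fin t → Fin n
    b : Fin t → Fin n
    a-inj : Injective _≡_ _≡_ a
    b-inj : Injective _≡_ _≡_ b

_∈T_ : ∀ {n t} → Perm n → Coset n t → Set
σ ∈T C = ∀ i → σ ⟨$⟩ʳ (Coset.a C i) ≡ Coset.b C i

DisjointCosets : ∀ {n t} → List (Coset n t) → Set
DisjointCosets Cs = AllPairs (λ C D → ∀ σ → σ ∈T C → σ ∈T D → Data.Empty.⊥) Cs
  where import Data.Empty

DisjointUnionOfCosets : ∀ {n} → ℕ → Family n → Set
DisjointUnionOfCosets {n} t 𝒜 =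
  Σ (List (Coset n t)) λ Cs →
    DisjointCosets Cs × (∀ σ → (σ ∈𝒜 𝒜) ⇔ Any (σ ∈T_) Cs)

StabilizerCoset : ∀ {n} → ℕ → Family n → Set
StabilizerCoset {n} t 𝒜 =
  Σ (Subset n) λ x → Σ (Subset n) λ y →
    ∣ x ∣ ≡ t × ∣ y ∣ ≡ t × (∀ σ → (σ ∈𝒜 𝒜) ⇔ (image σ x ≡ y))

module Submission where

-- Pick π₀ ∈ 𝒜 and a t-coset T = T_{a↦b} ⊆ 𝒜 containing it; put x = {a₁, …, aₜ}
-- and y = π₀(x). Every σ ∈ 𝒜 satisfies σ(x) = y. Otherwise ρ = σ⁻¹π₀ moves some
-- p ∈ x out of x, and we choose k fixing x pointwise so that every ρk-invariant
-- set either contains ∁x ∪ {p} or lies inside x ∖ {p}. Then π = π₀k ∈ T ⊆ 𝒜, yet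
-- a t-set z with σ(z) = π(z) is ρk-invariant, which t ≤ n − t forbids. The map k
-- sends w ∉ x to the last point outside x on the ρ⁻¹-orbit of the cyclic successor
-- w⁺ of w in ∁x, so that the ρk-orbit of w passes through x and re-enters ∁x at w⁺.
-- Thus 𝒜 is contained in {σ : σ(x) = y}, which has t!(n − t)! elements, and the
-- sizes force equality.

open import Defs
open import Data.Bool using (true; false; not; if_then_else_)
open import Data.Bool.Properties using (not-¬; ¬-not)
open import Data.Empty using (⊥; ⊥-elim)
open import Data.Fin using (Fin; zero; suc; toℕ; inject₁; punchIn; punchOut)
open import Data.Fin.Permutation
  using (permutation; flip; remove; _∘ₚ_; _⟨$⟩ʳ_; _⟨$⟩ˡ_; inverseˡ; inverseʳ)
open import Data.Fin.Properties
  using ( _≟_; any?; all?; injective⇒≤; pigeonhole; suc-injective; toℕ<n; toℕ-inject₁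
        ; punchOut-injective; punchIn-injective; punchInᵢ≢i; punchIn-punchOut; punchOut-punchIn)
open import Data.Fin.Subset as Subset using (Subset; ∣_∣; ∁; _⊂_; _⊆_)
open import Data.Fin.Subset.Properties using (p⊂q⇒∣p∣<∣q∣; ∣∁p∣≡n∸∣p∣; ∣p∣≤n; x∈p⇒x∉∁p; x∈∁p⇒x∉p)
open import Data.List using (List; []; _∷_; length; filter; map)
open import Data.List.Membership.Propositional using (_∈_; find; lose)
open import Data.List.Properties using (length-map)
open import Data.List.Relation.Unary.All as All using (All; []; _∷_)
import Data.List.Relation.Unary.All.Properties as All
open import Data.List.Relation.Unary.AllPairs using (AllPairs; []; _∷_)
import Data.List.Relation.Unary.AllPairs.Properties as AllPairs
open import Data.List.Relation.Unary.Any as Any using (here)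
open import Data.Nat using (ℕ; zero; suc; _+_; _*_; _∸_; _≤_; _≥_; _<_; z≤n; s≤s; _!)
open import Data.Nat.GeneralisedArithmetic using (iterate)
import Data.Nat.Properties as ℕ
open import Algebra.Properties.CommutativeMonoid.Sum ℕ.+-0-commutativeMonoid
  using (sum; sum-cong-≗; ∑-distrib-+; sum-replicate-zero)
open import Data.Product using (∃; ∃-syntax; _×_; _,_; proj₁; proj₂)
open import Data.Sum using (_⊎_; inj₁; inj₂)
open import Data.Vec using ([]; _∷_; lookup; tabulate; removeAt)
open import Data.Vec.Properties
  using (lookup∘tabulate; tabulate-cong; lookup⇒[]=; []=⇒lookup; lookup-map; removeAt-punchOut)
open import Function.Bundles using (Equivalence; mk⇔)
open import Function.Definitions using (Injective)
open import Relation.Binary.Definitions using (tri<; tri≈; tri>)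
open import Relation.Binary.PropositionalEquality
open import Relation.Nullary using (¬_; yes; no)
open import Relation.Nullary.Decidable using (⌊_⌋)

-- Membership as an equation on lookup p j, so that proofs can case split on that Boolean.
infix 4 _∈ₛ_ _∉ₛ_

_∈ₛ_ _∉ₛ_ : ∀ {n} → Fin n → Subset n → Set
j ∈ₛ p = lookup p j ≡ true
j ∉ₛ p = lookup p j ≡ false

∉⇒¬∈ : ∀ {b} → b ≡ false → ¬ b ≡ true
∉⇒¬∈ b≡false b≡true = not-¬ b≡true b≡false

∈∁⇒∉ₛ : ∀ {n} {p : Subset n} {j} → j Subset.∈ ∁ p → j ∉ₛ p
∈∁⇒∉ₛ {p = p} j∈∁p = ¬-not (λ j∈p → x∈∁p⇒x∉p j∈∁p (lookup⇒[]= _ p j∈p))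

enum : ∀ {n} (p : Subset n) → Fin ∣ p ∣ → Fin n
enum (true  ∷ p) zero    = zero
enum (true  ∷ p) (suc i) = suc (enum p i)
enum (false ∷ p) i       = suc (enum p i)

enum-∈ : ∀ {n} (p : Subset n) i → enum p i ∈ₛ p
enum-∈ (true  ∷ p) zero    = refl
enum-∈ (true  ∷ p) (suc i) = enum-∈ p i
enum-∈ (false ∷ p) i       = enum-∈ p i

enum-injective : ∀ {n} (p : Subset n) → Injective _≡_ _≡_ (enum p)
enum-injective (true  ∷ p) {zero}  {zero}  _  = refl
enum-injective (true  ∷ p) {suc i} {suc j} eq = cong suc (enum-injective p (suc-injective eq))
enum-injective (false ∷ p)                 eq = enum-injective p (suc-injective eq)

index : ∀ {n} (p : Subset n) j → j ∈ₛ p → Fin ∣ p ∣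
index (true  ∷ p) zero    _   = zero
index (true  ∷ p) (suc j) j∈p = suc (index p j j∈p)
index (false ∷ p) (suc j) j∈p = index p j j∈p

enum-index : ∀ {n} (p : Subset n) j (j∈p : j ∈ₛ p) → enum p (index p j j∈p) ≡ j
enum-index (true  ∷ p) zero    _   = refl
enum-index (true  ∷ p) (suc j) j∈p = cong suc (enum-index p j j∈p)
enum-index (false ∷ p) (suc j) j∈p = cong suc (enum-index p j j∈p)

injective-into⇒≤∣p∣ : ∀ {m n} (p : Subset n) (f : Fin m → Fin n) →
                      Injective _≡_ _≡_ f → (∀ i → f i ∈ₛ p) → m ≤ ∣ p ∣
injective-into⇒≤∣p∣ p f f-inj f∈p = injective⇒≤ index∘f-injective
  where
  index∘f-injective : Injective _≡_ _≡_ (λ i → index p (f i) (f∈p i))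
  index∘f-injective {i} {j} eq = f-inj (begin
    f i                               ≡⟨ enum-index p (f i) (f∈p i) ⟨
    enum p (index p (f i) (f∈p i))    ≡⟨ cong (enum p) eq ⟩
    enum p (index p (f j) (f∈p j))    ≡⟨ enum-index p (f j) (f∈p j) ⟩
    f j                               ∎)
    where open ≡-Reasoning

covering⇒∣p∣≤ : ∀ {m n} (p : Subset n) (f : Fin m → Fin n) →
                (∀ j → j ∈ₛ p → ∃ λ i → f i ≡ j) → ∣ p ∣ ≤ m
covering⇒∣p∣≤ p f cover = injective⇒≤ preimage-injective
  where
  preimage : Fin ∣ p ∣ → _
  preimage i = proj₁ (cover (enum p i) (enum-∈ p i))
  preimage-injective : Injective _≡_ _≡_ preimage
  preimage-injective {i} {j} eq = enum-injective p (begin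
    enum p i          ≡⟨ proj₂ (cover (enum p i) (enum-∈ p i)) ⟨
    f (preimage i)    ≡⟨ cong f eq ⟩
    f (preimage j)    ≡⟨ proj₂ (cover (enum p j) (enum-∈ p j)) ⟩
    enum p j          ∎)
    where open ≡-Reasoning

range : ∀ {n t} → (Fin t → Fin n) → Subset n
range a = tabulate (λ j → ⌊ any? (λ i → a i ≟ j) ⌋)

module _ {n t} (a : Fin t → Fin n) where

  ∈-range : ∀ i → a i ∈ₛ range a
  ∈-range i rewrite lookup∘tabulate (λ j → ⌊ any? (λ i → a i ≟ j) ⌋) (a i)
    with any? (λ i′ → a i′ ≟ a i)
  ... | yes _ = refl
  ... | no ∄i = ⊥-elim (∄i (i , refl))

  range-preimage : ∀ j → j ∈ₛ range a → ∃ λ i → a i ≡ j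
  range-preimage j j∈ rewrite lookup∘tabulate (λ j → ⌊ any? (λ i → a i ≟ j) ⌋) j
    with any? (λ i → a i ≟ j)
  ... | yes ∃i = ∃i

  ∣range∣ : Injective _≡_ _≡_ a → ∣ range a ∣ ≡ t
  ∣range∣ a-inj = ℕ.≤-antisym (covering⇒∣p∣≤ (range a) a range-preimage)
                              (injective-into⇒≤∣p∣ (range a) a a-inj ∈-range)

crossing⇒⊂ : ∀ {n} (x z : Subset n) {p q} → p ∈ₛ x → q ∉ₛ x → lookup z p ≡ lookup z q →
             (∀ {w} → w ∉ₛ x → lookup z w ≡ lookup z q) → ∁ x ⊂ z ⊎ z ⊂ x
crossing⇒⊂ x z {p} {q} p∈x q∉x zp≡zq constant with lookup z q
... | true  = inj₁ ((λ w∈∁x → lookup⇒[]= _ z (constant (∈∁⇒∉ₛ w∈∁x))) ,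
                    p , lookup⇒[]= p z zp≡zq , x∈p⇒x∉∁p (lookup⇒[]= p x p∈x))
... | false = inj₂ (z⊆x , p , lookup⇒[]= p x p∈x , λ p∈z → ∉⇒¬∈ zp≡zq ([]=⇒lookup p∈z))
  where
  z⊆x : z ⊆ x
  z⊆x {w} w∈z with lookup x w in w∈x?
  ... | true  = lookup⇒[]= w x w∈x?
  ... | false = ⊥-elim (∉⇒¬∈ (constant w∈x?) ([]=⇒lookup w∈z))

¬∁⊂⊎⊂ : ∀ {n t} (x z : Subset n) → ∣ x ∣ ≡ t → ∣ z ∣ ≡ t → t ≤ n ∸ t → ¬ (∁ x ⊂ z ⊎ z ⊂ x)
¬∁⊂⊎⊂ {n} x z ∣x∣≡t ∣z∣≡t t≤n∸t (inj₁ ∁x⊂z) =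
  ℕ.<⇒≱ (subst₂ _<_ (trans (∣∁p∣≡n∸∣p∣ x) (cong (n ∸_) ∣x∣≡t)) ∣z∣≡t (p⊂q⇒∣p∣<∣q∣ ∁x⊂z)) t≤n∸t
¬∁⊂⊎⊂ x z ∣x∣≡t ∣z∣≡t _ (inj₂ z⊂x) = ℕ.<-irrefl refl (subst₂ _<_ ∣z∣≡t ∣x∣≡t (p⊂q⇒∣p∣<∣q∣ z⊂x))

⟨$⟩ʳ-injective : ∀ {n} (ρ : Perm n) → Injective _≡_ _≡_ (ρ ⟨$⟩ʳ_)
⟨$⟩ʳ-injective ρ eq = trans (sym (inverseˡ ρ)) (trans (cong (ρ ⟨$⟩ˡ_) eq) (inverseˡ ρ))

⟨$⟩ˡ-injective : ∀ {n} (ρ : Perm n) → Injective _≡_ _≡_ (ρ ⟨$⟩ˡ_)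
⟨$⟩ˡ-injective ρ = ⟨$⟩ʳ-injective (flip ρ)

lookup-image : ∀ {n} (σ : Perm n) p j → lookup (image σ p) j ≡ lookup p (σ ⟨$⟩ˡ j)
lookup-image σ p = lookup∘tabulate (λ j → lookup p (σ ⟨$⟩ˡ j))

image≡⇒invariant : ∀ {n} (σ π : Perm n) z → image σ z ≡ image π z →
                   ∀ w → lookup z w ≡ lookup z (σ ⟨$⟩ˡ (π ⟨$⟩ʳ w))
image≡⇒invariant σ π z σz≡πz w = begin
  lookup z w                       ≡⟨ cong (lookup z) (inverseˡ π) ⟨
  lookup z (π ⟨$⟩ˡ (π ⟨$⟩ʳ w))     ≡⟨ lookup-image π z _ ⟨
  lookup (image π z) (π ⟨$⟩ʳ w)    ≡⟨ cong (λ q → lookup q (π ⟨$⟩ʳ w)) σz≡πz ⟨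
  lookup (image σ z) (π ⟨$⟩ʳ w)    ≡⟨ lookup-image σ z _ ⟩
  lookup z (σ ⟨$⟩ˡ (π ⟨$⟩ʳ w))     ∎
  where open ≡-Reasoning

invariant⇒image≡ : ∀ {n} (σ π : Perm n) x →
                   (∀ u → lookup x (σ ⟨$⟩ˡ (π ⟨$⟩ʳ u)) ≡ lookup x u) → image σ x ≡ image π x
invariant⇒image≡ σ π x invariant = tabulate-cong λ j →
  trans (cong (λ v → lookup x (σ ⟨$⟩ˡ v)) (sym (inverseʳ π))) (invariant (π ⟨$⟩ˡ j))

∣image∣ : ∀ {n} (σ : Perm n) p → ∣ image σ p ∣ ≡ ∣ p ∣
∣image∣ σ p = ℕ.≤-antisym (covering⇒∣p∣≤ (image σ p) σ∘enum covers)
                          (injective-into⇒≤∣p∣ (image σ p) σ∘enum σ∘enum-injective σ∘enum-∈)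
  where
  σ∘enum : Fin ∣ p ∣ → _
  σ∘enum i = σ ⟨$⟩ʳ enum p i
  σ∘enum-injective : Injective _≡_ _≡_ σ∘enum
  σ∘enum-injective eq = enum-injective p (⟨$⟩ʳ-injective σ eq)
  σ∘enum-∈ : ∀ i → σ∘enum i ∈ₛ image σ p
  σ∘enum-∈ i = trans (lookup-image σ p _) (trans (cong (lookup p) (inverseˡ σ)) (enum-∈ p i))
  covers : ∀ j → j ∈ₛ image σ p → ∃ λ i → σ∘enum i ≡ j
  covers j j∈ = index p _ σ⁻¹j∈p , trans (cong (σ ⟨$⟩ʳ_) (enum-index p _ σ⁻¹j∈p)) (inverseʳ σ)
    where σ⁻¹j∈p = trans (sym (lookup-image σ p j)) j∈

injective⇒surjective : ∀ {n} (f : Fin n → Fin n) → Injective _≡_ _≡_ f → ∀ j → ∃ λ i → f i ≡ j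
injective⇒surjective {suc n} f f-inj j with any? (λ i → f i ≟ j)
... | yes ∃i = ∃i
... | no ∄i = ⊥-elim (ℕ.1+n≰n (injective⇒≤ squeeze-injective))
  where
  squeeze : Fin (suc n) → Fin n
  squeeze i = punchOut {i = j} (λ eq → ∄i (i , sym eq))
  squeeze-injective : Injective _≡_ _≡_ squeeze
  squeeze-injective {i} {i′} eq =
    f-inj (punchOut-injective (λ eq → ∄i (i , sym eq)) (λ eq → ∄i (i′ , sym eq)) eq)

injective⇒permutation : ∀ {n} (f : Fin n → Fin n) → Injective _≡_ _≡_ f → Perm n
injective⇒permutation f f-inj = permutation f (λ j → proj₁ (surjective j))
  (λ j → proj₂ (surjective j)) (λ i → f-inj (proj₂ (surjective (f i))))
  where
  surjective : ∀ j → ∃ λ i → f i ≡ j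
  surjective = injective⇒surjective f f-inj

-- Orbits leaving a subset

<⇒+suc : ∀ {m n} → m < n → ∃ λ e → m + suc e ≡ n
<⇒+suc {m} m<n with e , m+1+e≡n ← ℕ.m≤n⇒∃[o]m+o≡n m<n = e , trans (ℕ.+-suc m e) m+1+e≡n

module _ {A : Set} (r : A → A) where

  iterate-suc : ∀ u k → iterate r u (suc k) ≡ r (iterate r u k)
  iterate-suc u zero    = refl
  iterate-suc u (suc k) = iterate-suc (r u) k

  iterate-+ : ∀ u a b → iterate r u (a + b) ≡ iterate r (iterate r u a) b
  iterate-+ u zero    b = refl
  iterate-+ u (suc a) b = iterate-+ (r u) a b

  module _ (r-inj : Injective _≡_ _≡_ r) where

    iterate-injective : ∀ k {u u′} → iterate r u k ≡ iterate r u′ k → u ≡ u′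
    iterate-injective zero    eq = eq
    iterate-injective (suc k) eq = r-inj (iterate-injective k eq)

    iterate-gap : ∀ d e {v u} → iterate r (r v) d ≡ iterate r u (d + suc e) → v ≡ iterate r u e
    iterate-gap d e {v} {u} eq = r-inj (begin
      r v                  ≡⟨ iterate-injective d shifted ⟩
      iterate r u (suc e)  ≡⟨ iterate-suc u e ⟩
      r (iterate r u e)    ∎)
      where
      open ≡-Reasoning
      shifted : iterate r (r v) d ≡ iterate r (iterate r u (suc e)) d
      shifted = trans eq (trans (cong (iterate r u) (ℕ.+-comm d (suc e))) (iterate-+ u (suc e) d))

module FirstExit {n} (x : Subset n) (r : Fin n → Fin n) where

  -- exit f u is the first of u, r u, r² u, … outside x, searching f steps (r^f u if none is found).
  exitTime : ℕ → Fin n → ℕ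
  exitTime zero    u = zero
  exitTime (suc f) u = if lookup x u then suc (exitTime f (r u)) else zero

  exit : ℕ → Fin n → Fin n
  exit f u = iterate r u (exitTime f u)

  ∈-before-exit : ∀ f u i → i < exitTime f u → iterate r u i ∈ₛ x
  ∈-before-exit (suc f) u i i< with lookup x u in u∈?
  ∈-before-exit (suc f) u zero    _        | true = u∈?
  ∈-before-exit (suc f) u (suc i) (s≤s i<) | true = ∈-before-exit f (r u) i i<

  exit-∈⇒exitTime≡ : ∀ f u → exit f u ∈ₛ x → exitTime f u ≡ f
  exit-∈⇒exitTime≡ zero    u _     = refl
  exit-∈⇒exitTime≡ (suc f) u exit∈ with lookup x u in u∈?
  ... | true  = cong suc (exit-∈⇒exitTime≡ f (r u) exit∈)
  ... | false = ⊥-elim (∉⇒¬∈ u∈? exit∈)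

  exit-invariant : {A : Set} (W : Fin n → A) → (∀ u → u ∈ₛ x → W (r u) ≡ W u) →
                   ∀ f u → W (exit f u) ≡ W u
  exit-invariant W W-inv zero    u = refl
  exit-invariant W W-inv (suc f) u with lookup x u in u∈?
  ... | true  = trans (exit-invariant W W-inv f (r u)) (W-inv u u∈?)
  ... | false = refl

  -- For injective r and v ∉ x the orbit of v returns to ∁x within n steps (pigeonhole),
  -- so next v is that first return.
  next : Fin n → Fin n
  next v = exit n (r v)

  module _ (r-inj : Injective _≡_ _≡_ r) where

    orbit-leaves : ∀ v → v ∉ₛ x → ¬ (∀ i → i ≤ n → iterate r (r v) i ∈ₛ x)
    orbit-leaves v v∉ all∈
      with i , j , i<j , same ← pigeonhole (ℕ.n<1+n n) (λ (i : Fin (suc n)) → iterate r (r v) (toℕ i))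
      with e , i+1+e≡j ← <⇒+suc i<j
      = ∉⇒¬∈ v∉ (subst (_∈ₛ x) (sym v≡) (all∈ e e≤n))
      where
      v≡ : v ≡ iterate r (r v) e
      v≡ = iterate-gap r r-inj (toℕ i) e (trans same (cong (iterate r (r v)) (sym i+1+e≡j)))
      e≤n : e ≤ n
      e≤n = ℕ.≤-pred (ℕ.<-trans (subst (e <_) i+1+e≡j (ℕ.m≤n+m (suc e) (toℕ i))) (toℕ<n j))

    next-∉ : ∀ v → v ∉ₛ x → next v ∉ₛ x
    next-∉ v v∉ with lookup x (next v) in next∈?
    ... | false = refl
    ... | true  = ⊥-elim (orbit-leaves v v∉ all∈)
      where
      time≡n : exitTime n (r v) ≡ n
      time≡n = exit-∈⇒exitTime≡ n (r v) next∈?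
      all∈ : ∀ i → i ≤ n → iterate r (r v) i ∈ₛ x
      all∈ i i≤n with ℕ.m≤n⇒m<n∨m≡n i≤n
      ... | inj₁ i<n  = ∈-before-exit n (r v) i (subst (i <_) (sym time≡n) i<n)
      ... | inj₂ refl = subst (λ k → iterate r (r v) k ∈ₛ x) time≡n next∈?

    earlier-visit⇒∈ : ∀ d v v′ → d < exitTime n (r v′) → iterate r (r v) d ≡ next v′ → v ∈ₛ x
    earlier-visit⇒∈ d v v′ d< visit with e , d+1+e≡ ← <⇒+suc d< =
      subst (_∈ₛ x) (sym v≡) (∈-before-exit n (r v′) e e<)
      where
      v≡ : v ≡ iterate r (r v′) e
      v≡ = iterate-gap r r-inj d e (trans visit (cong (iterate r (r v′)) (sym d+1+e≡)))
      e< : e < exitTime n (r v′)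
      e< = subst (e <_) d+1+e≡ (ℕ.m≤n+m (suc e) d)

    next-injective : ∀ {v v′} → v ∉ₛ x → v′ ∉ₛ x → next v ≡ next v′ → v ≡ v′
    next-injective {v} {v′} v∉ v′∉ same with ℕ.<-cmp (exitTime n (r v)) (exitTime n (r v′))
    ... | tri< lt _ _ = ⊥-elim (∉⇒¬∈ v∉ (earlier-visit⇒∈ _ v v′ lt same))
    ... | tri> _ _ gt = ⊥-elim (∉⇒¬∈ v′∉ (earlier-visit⇒∈ _ v′ v gt (sym same)))
    ... | tri≈ _ eq _ =
      r-inj (iterate-injective r r-inj (exitTime n (r v)) (trans same (cong (iterate r (r v′)) (sym eq))))

    next-invariant⇒orbit-invariant : {A : Set} (Z : Fin n → A) → (∀ w → w ∉ₛ x → Z w ≡ Z (next w)) →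
      ∀ i u → u ∉ₛ x → iterate r u i ∉ₛ x → Z u ≡ Z (iterate r u i)
    next-invariant⇒orbit-invariant Z Z-inv i u = go i i u ℕ.≤-refl
      where
      go : ∀ N i u → i ≤ N → u ∉ₛ x → iterate r u i ∉ₛ x → Z u ≡ Z (iterate r u i)
      go _       zero    u _         _  _    = refl
      go (suc N) (suc i) u (s≤s i≤N) u∉ end∉ with ℕ.<-cmp i (exitTime n (r u))
      ... | tri< i<d _ _ = ⊥-elim (∉⇒¬∈ end∉ (∈-before-exit n (r u) i i<d))
      ... | tri≈ _ i≡d _ = trans (Z-inv u u∉) (cong (λ k → Z (iterate r (r u) k)) (sym i≡d))
      ... | tri> _ _ d<i =
        trans (Z-inv u u∉) (trans (go N e (next u) e≤N (next-∉ u u∉) (subst (_∉ₛ x) split end∉))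
                                  (cong Z (sym split)))
        where
        d e : ℕ
        d = exitTime n (r u)
        e = i ∸ d
        split : iterate r (r u) i ≡ iterate r (next u) e
        split = trans (cong (iterate r (r u)) (sym (ℕ.m+[n∸m]≡n (ℕ.<⇒≤ d<i)))) (iterate-+ r (r u) d e)
        e≤N : e ≤ N
        e≤N = ℕ.≤-trans (ℕ.m∸n≤m i d) i≤N

    ∈-preserving⇒∉-preserving : (∀ p → p ∈ₛ x → r p ∈ₛ x) → ∀ v → v ∉ₛ x → r v ∉ₛ x
    ∈-preserving⇒∉-preserving preserves v v∉ with lookup x (r v) in rv∈?
    ... | false = refl
    ... | true  = ⊥-elim (leaves (exitTime n (r v)) refl)
      where
      leaves : ∀ d → exitTime n (r v) ≡ d → ⊥
      leaves zero    d≡ = ∉⇒¬∈ (next-∉ v v∉) (subst (λ k → iterate r (r v) k ∈ₛ x) (sym d≡) rv∈?)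
      leaves (suc d) d≡ = ∉⇒¬∈ (next-∉ v v∉) (subst (_∈ₛ x) rp≡next (preserves p p∈))
        where
        p : Fin n
        p = iterate r (r v) d
        p∈ : p ∈ₛ x
        p∈ = ∈-before-exit n (r v) d (subst (d <_) (sym d≡) (ℕ.n<1+n d))
        rp≡next : r p ≡ next v
        rp≡next = trans (sym (iterate-suc r (r v) d)) (cong (iterate r (r v)) (sym d≡))

-- Rerouting outside a subset

-- i ↦ i + 1 (mod m + 1)
sucMod : ∀ {m} → Fin (suc m) → Fin (suc m)
sucMod {zero}  zero    = zero
sucMod {suc m} zero    = suc zero
sucMod {suc m} (suc i) = punchIn (suc zero) (sucMod i)

sucMod-injective : ∀ {m} → Injective _≡_ _≡_ (sucMod {m})
sucMod-injective {zero}  {zero}  {zero}  _  = refl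
sucMod-injective {suc m} {zero}  {zero}  _  = refl
sucMod-injective {suc m} {zero}  {suc j} eq = ⊥-elim (punchInᵢ≢i (suc zero) (sucMod j) (sym eq))
sucMod-injective {suc m} {suc i} {zero}  eq = ⊥-elim (punchInᵢ≢i (suc zero) (sucMod i) eq)
sucMod-injective {suc m} {suc i} {suc j} eq =
  cong suc (sucMod-injective (punchIn-injective (suc zero) (sucMod i) (sucMod j) eq))

sucMod-inject₁ : ∀ {m} (i : Fin m) → sucMod (inject₁ i) ≡ suc i
sucMod-inject₁ {suc m} zero    = refl
sucMod-inject₁ {suc m} (suc i) = cong (punchIn (suc zero)) (sucMod-inject₁ i)

iterate-sucMod : ∀ {m} k (w : Fin (suc m)) → toℕ w ≡ k → iterate sucMod zero k ≡ w
iterate-sucMod zero    zero    _  = refl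
iterate-sucMod (suc k) (suc w) eq = begin
  iterate sucMod zero (suc k)     ≡⟨ iterate-suc sucMod zero k ⟩
  sucMod (iterate sucMod zero k)  ≡⟨ cong sucMod (iterate-sucMod k (inject₁ w) w′≡k) ⟩
  sucMod (inject₁ w)              ≡⟨ sucMod-inject₁ w ⟩
  suc w                           ∎
  where
  open ≡-Reasoning
  w′≡k : toℕ (inject₁ w) ≡ k
  w′≡k = trans (toℕ-inject₁ w) (ℕ.suc-injective eq)

module _ {m} (x : Subset (suc m)) {A : Set} (Z : Fin (suc m) → A)
         (Z-inv : ∀ w → w ∉ₛ x → Z w ≡ Z (FirstExit.next x sucMod w)) where

  private
    constant-upwards : ∀ {w w′} → w ∉ₛ x → w′ ∉ₛ x → toℕ w ≤ toℕ w′ → Z w ≡ Z w′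
    constant-upwards {w} {w′} w∉ w′∉ w≤w′ = trans
      (FirstExit.next-invariant⇒orbit-invariant x sucMod sucMod-injective Z Z-inv gap w w∉
        (subst (_∉ₛ x) (sym reach) w′∉))
      (cong Z reach)
      where
      gap : ℕ
      gap = toℕ w′ ∸ toℕ w
      reach : iterate sucMod w gap ≡ w′
      reach = begin
        iterate sucMod w gap                                ≡⟨ cong (λ v → iterate sucMod v gap) (iterate-sucMod _ w refl) ⟨
        iterate sucMod (iterate sucMod zero (toℕ w)) gap    ≡⟨ iterate-+ sucMod zero (toℕ w) gap ⟨
        iterate sucMod zero (toℕ w + gap)                   ≡⟨ iterate-sucMod _ w′ (sym (ℕ.m+[n∸m]≡n w≤w′)) ⟩
        w′                                                  ∎
        where open ≡-Reasoning

  next-sucMod-invariant⇒constant : ∀ {w w′} → w ∉ₛ x → w′ ∉ₛ x → Z w ≡ Z w′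
  next-sucMod-invariant⇒constant {w} {w′} w∉ w′∉ with ℕ.≤-total (toℕ w) (toℕ w′)
  ... | inj₁ w≤w′ = constant-upwards w∉ w′∉ w≤w′
  ... | inj₂ w′≤w = sym (constant-upwards w′∉ w∉ w′≤w)

module Rerouting {m} (x : Subset (suc m)) (ρ : Perm (suc m)) where

  open FirstExit x sucMod using ()
    renaming (next to cyclicNext; next-∉ to cyclicNext-∉; next-injective to cyclicNext-injective)
  open FirstExit x (ρ ⟨$⟩ˡ_) using ()
    renaming (next to back; next-∉ to back-∉; next-injective to back-injective; exit-invariant to back-invariant)

  -- The first return of ρ ∘ reroute to ∁x is cyclicNext, the cyclic successor within ∁x.
  reroute : Fin (suc m) → Fin (suc m)
  reroute w = if lookup x w then w else back (cyclicNext w)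

  reroute-∈ : ∀ {w} → w ∈ₛ x → reroute w ≡ w
  reroute-∈ w∈ rewrite w∈ = refl

  reroute-∉ : ∀ {w} → w ∉ₛ x → reroute w ≡ back (cyclicNext w)
  reroute-∉ w∉ rewrite w∉ = refl

  back∘cyclicNext-∉ : ∀ {w} → w ∉ₛ x → back (cyclicNext w) ∉ₛ x
  back∘cyclicNext-∉ w∉ = back-∉ (⟨$⟩ˡ-injective ρ) _ (cyclicNext-∉ sucMod-injective _ w∉)

  reroute-injective : Injective _≡_ _≡_ reroute
  reroute-injective {a} {b} eq with lookup x a in a∈? | lookup x b in b∈?
  ... | true  | true  = eq
  ... | false | false = cyclicNext-injective sucMod-injective a∈? b∈?
    (back-injective (⟨$⟩ˡ-injective ρ) (cyclicNext-∉ sucMod-injective _ a∈?)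
                                       (cyclicNext-∉ sucMod-injective _ b∈?) eq)
  ... | true  | false = ⊥-elim (∉⇒¬∈ (back∘cyclicNext-∉ b∈?) (subst (_∈ₛ x) eq a∈?))
  ... | false | true  = ⊥-elim (∉⇒¬∈ (back∘cyclicNext-∉ a∈?) (subst (_∈ₛ x) (sym eq) b∈?))

  module _ {A : Set} (Z : Fin (suc m) → A) (Z-inv : ∀ w → Z w ≡ Z (ρ ⟨$⟩ʳ reroute w)) where

    invariant-inside : ∀ {y} → y ∈ₛ x → Z y ≡ Z (ρ ⟨$⟩ʳ y)
    invariant-inside {y} y∈ = trans (Z-inv y) (cong (λ v → Z (ρ ⟨$⟩ʳ v)) (reroute-∈ y∈))

    constant-outside : ∀ {w w′} → w ∉ₛ x → w′ ∉ₛ x → Z w ≡ Z w′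
    constant-outside = next-sucMod-invariant⇒constant x Z invariant-cyclicNext
      where
      invariant-cyclicNext : ∀ w → w ∉ₛ x → Z w ≡ Z (cyclicNext w)
      invariant-cyclicNext w w∉ = begin
        Z w                                      ≡⟨ Z-inv w ⟩
        Z (ρ ⟨$⟩ʳ reroute w)                     ≡⟨ cong (λ v → Z (ρ ⟨$⟩ʳ v)) (reroute-∉ w∉) ⟩
        Z (ρ ⟨$⟩ʳ back (cyclicNext w))           ≡⟨ back-invariant (λ v → Z (ρ ⟨$⟩ʳ v)) step (suc m) _ ⟩
        Z (ρ ⟨$⟩ʳ (ρ ⟨$⟩ˡ cyclicNext w))         ≡⟨ cong Z (inverseʳ ρ) ⟩
        Z (cyclicNext w)                         ∎
        where
        open ≡-Reasoning
        step : ∀ u → u ∈ₛ x → Z (ρ ⟨$⟩ʳ (ρ ⟨$⟩ˡ u)) ≡ Z (ρ ⟨$⟩ʳ u)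
        step u u∈ = trans (cong Z (inverseʳ ρ)) (invariant-inside u∈)

AgreeOn : ∀ {n} → Subset n → Perm n → Perm n → Set
AgreeOn x π π₀ = ∀ u → u ∈ₛ x → π ⟨$⟩ʳ u ≡ π₀ ⟨$⟩ʳ u

module _ {m t} (x : Subset (suc m)) (∣x∣≡t : ∣ x ∣ ≡ t) (t≤n∸t : t ≤ suc m ∸ t) (σ π₀ : Perm (suc m))
         (intersects : ∀ π → AgreeOn x π π₀ → ∃[ z ] (∣ z ∣ ≡ t × image σ z ≡ image π z)) where

  private
    ρ : Perm (suc m)
    ρ = π₀ ∘ₚ flip σ

    open Rerouting x ρ

    π : Perm (suc m)
    π = injective⇒permutation (λ w → π₀ ⟨$⟩ʳ reroute w) (λ eq → reroute-injective (⟨$⟩ʳ-injective π₀ eq))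

    π-agrees : AgreeOn x π π₀
    π-agrees u u∈ = cong (π₀ ⟨$⟩ʳ_) (reroute-∈ u∈)

    no-crossing : ∀ {p} → p ∈ₛ x → ρ ⟨$⟩ʳ p ∉ₛ x → ⊥
    no-crossing {p} p∈ ρp∉ with z , ∣z∣≡t , σz≡πz ← intersects π π-agrees =
      ¬∁⊂⊎⊂ x z ∣x∣≡t ∣z∣≡t t≤n∸t
        (crossing⇒⊂ x z p∈ ρp∉ (invariant-inside (lookup z) z-inv p∈)
                               (λ w∉ → constant-outside (lookup z) z-inv w∉ ρp∉))
      where
      z-inv : ∀ w → lookup z w ≡ lookup z (ρ ⟨$⟩ʳ reroute w)
      z-inv = image≡⇒invariant σ π z σz≡πz

    ρ-preserves-∈ : ∀ p → p ∈ₛ x → ρ ⟨$⟩ʳ p ∈ₛ x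
    ρ-preserves-∈ p p∈ = ¬-not (no-crossing p∈)

    ρ-preserves : ∀ u → lookup x (ρ ⟨$⟩ʳ u) ≡ lookup x u
    ρ-preserves u with lookup x u in u∈?
    ... | true  = ρ-preserves-∈ u u∈?
    ... | false = FirstExit.∈-preserving⇒∉-preserving x (ρ ⟨$⟩ʳ_) (⟨$⟩ʳ-injective ρ) ρ-preserves-∈ u u∈?

  intersects-all-agreeing⇒image≡ : image σ x ≡ image π₀ x
  intersects-all-agreeing⇒image≡ = invariant⇒image≡ σ π₀ x ρ-preserves

-- Counting permutations that send x to y

sum-mono-≤ : ∀ {m} {f g : Fin m → ℕ} → (∀ j → f j ≤ g j) → sum f ≤ sum g
sum-mono-≤ {zero}  _   = z≤n
sum-mono-≤ {suc m} f≤g = ℕ.+-mono-≤ (f≤g zero) (sum-mono-≤ (λ j → f≤g (suc j)))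

sum-select : ∀ {m} (p : Subset m) c → sum (λ j → if lookup p j then c else 0) ≡ ∣ p ∣ * c
sum-select []          c = refl
sum-select (true  ∷ p) c = cong (c +_) (sum-select p c)
sum-select (false ∷ p) c = sum-select p c

δ : ∀ {m} → Fin m → Fin m → ℕ
δ i j = if ⌊ i ≟ j ⌋ then 1 else 0

sum-δ : ∀ {m} (i : Fin m) → sum (δ i) ≡ 1
sum-δ {suc m} zero    = cong suc (sum-replicate-zero m)
sum-δ {suc m} (suc i) = trans (sum-cong-≗ (δ-suc i)) (sum-δ i)
  where
  δ-suc : ∀ {m} (i j : Fin m) → δ (suc i) (suc j) ≡ δ i j
  δ-suc i j with i ≟ j
  ... | yes _ = refl
  ... | no  _ = refl

module _ {A : Set} {m} (label : A → Fin m) where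

  fibre : Fin m → List A → List A
  fibre j = filter (λ a → label a ≟ j)

  length-fibre-∷ : ∀ j a L → length (fibre j (a ∷ L)) ≡ δ (label a) j + length (fibre j L)
  length-fibre-∷ j a L with label a ≟ j
  ... | yes _ = refl
  ... | no  _ = refl

  length≡∑fibres : ∀ L → length L ≡ sum (λ j → length (fibre j L))
  length≡∑fibres []      = sym (sum-replicate-zero m)
  length≡∑fibres (a ∷ L) = begin
    suc (length L)                                           ≡⟨ cong₂ _+_ (sym (sum-δ (label a))) (length≡∑fibres L) ⟩
    sum (δ (label a)) + sum (λ j → length (fibre j L))       ≡⟨ ∑-distrib-+ (δ (label a)) (λ j → length (fibre j L)) ⟨
    sum (λ j → δ (label a) j + length (fibre j L))           ≡⟨ sum-cong-≗ (λ j → length-fibre-∷ j a L) ⟨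
    sum (λ j → length (fibre j (a ∷ L)))                     ∎
    where open ≡-Reasoning

  length≤∑bounds : (B : Fin m → ℕ) (L : List A) → (∀ j → length (fibre j L) ≤ B j) → length L ≤ sum B
  length≤∑bounds B L fibre≤ = subst (_≤ sum B) (sym (length≡∑fibres L)) (sum-mono-≤ fibre≤)

Sends : ∀ {n} → Perm n → Subset n → Subset n → Set
Sends σ x y = ∀ j → lookup x (σ ⟨$⟩ˡ j) ≡ lookup y j

image≡⇒Sends : ∀ {n} (σ : Perm n) x {y} → image σ x ≡ y → Sends σ x y
image≡⇒Sends σ x σx≡y j = trans (sym (lookup-image σ x j)) (cong (λ q → lookup q j) σx≡y)

Sends-∁ : ∀ {n} {σ : Perm n} {x y} → Sends σ x y → Sends σ (∁ x) (∁ y)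
Sends-∁ {σ = σ} {x} {y} sends j =
  trans (lookup-map (σ ⟨$⟩ˡ j) not x) (trans (cong not (sends j)) (sym (lookup-map j not y)))

Sends-head : ∀ {n} (σ : Perm (suc n)) {b x y} → Sends σ (b ∷ x) y → lookup y (σ ⟨$⟩ʳ zero) ≡ b
Sends-head σ {b} {x} sends = trans (sym (sends (σ ⟨$⟩ʳ zero))) (cong (lookup (b ∷ x)) (inverseˡ σ))

lookup-removeAt : ∀ {n} (y : Subset (suc n)) i j → lookup (removeAt y i) j ≡ lookup y (punchIn i j)
lookup-removeAt y i j = trans (cong (lookup (removeAt y i)) (sym (punchOut-punchIn i)))
                              (removeAt-punchOut y (λ eq → punchInᵢ≢i i j (sym eq)))

Sends-remove : ∀ {n} (σ : Perm (suc n)) {b x y} → Sends σ (b ∷ x) y →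
               Sends (remove zero σ) x (removeAt y (σ ⟨$⟩ʳ zero))
Sends-remove σ {b} {x} {y} sends j = begin
  lookup x (remove zero σ ⟨$⟩ˡ j)                   ≡⟨ removeAt-punchOut (b ∷ x) {zero} {σ ⟨$⟩ˡ punchIn (σ ⟨$⟩ʳ zero) j} _ ⟩
  lookup (b ∷ x) (σ ⟨$⟩ˡ punchIn (σ ⟨$⟩ʳ zero) j)   ≡⟨ sends _ ⟩
  lookup y (punchIn (σ ⟨$⟩ʳ zero) j)                ≡⟨ lookup-removeAt y (σ ⟨$⟩ʳ zero) j ⟨
  lookup (removeAt y (σ ⟨$⟩ʳ zero)) j               ∎
  where open ≡-Reasoning

remove-≈ₚ⇒≈ₚ : ∀ {n} (σ π : Perm (suc n)) → σ ⟨$⟩ʳ zero ≡ π ⟨$⟩ʳ zero →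
            remove zero σ ≈ₚ remove zero π → σ ≈ₚ π
remove-≈ₚ⇒≈ₚ σ π σ0≡π0 _    zero    = σ0≡π0
remove-≈ₚ⇒≈ₚ σ π σ0≡π0 rσ≈rπ (suc i) = trans (sym (punchIn-punchOut _))
  (trans (cong₂ punchIn σ0≡π0 (rσ≈rπ i)) (punchIn-punchOut _))

∣removeAt∣ : ∀ {n} (y : Subset (suc n)) j → j ∈ₛ y → suc ∣ removeAt y j ∣ ≡ ∣ y ∣
∣removeAt∣ (true ∷ y)      zero    _   = refl
∣removeAt∣ (b ∷ b′ ∷ y)    (suc j) j∈y with ∣removeAt∣ (b′ ∷ y) j j∈y
∣removeAt∣ (true  ∷ b′ ∷ y) (suc j) j∈y | eq = cong suc eq
∣removeAt∣ (false ∷ b′ ∷ y) (suc j) j∈y | eq = eq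

distinct-removes : ∀ {n} j (F : Family (suc n)) → All (λ σ → σ ⟨$⟩ʳ zero ≡ j) F → Distinct F →
                   Distinct (map (remove zero) F)
distinct-removes j F F0 dist = AllPairs.map⁺ (go F F0 dist)
  where
  go : ∀ F → All (λ σ → σ ⟨$⟩ʳ zero ≡ j) F → Distinct F →
       AllPairs (λ σ π → ¬ remove zero σ ≈ₚ remove zero π) F
  go []      []          []          = []
  go (σ ∷ F) (σ0 ∷ F0) (σ∉F ∷ dist) =
    All.zipWith (λ {π} (σ≉π , π0) rσ≈rπ → σ≉π (remove-≈ₚ⇒≈ₚ σ π (trans σ0 (sym π0)) rσ≈rπ)) (σ∉F , F0) ∷ go F F0 dist

complement-factorials : ∀ {n k} → k ≤ n → suc (n ∸ k) ! * (n ∸ (n ∸ k)) ! ≡ k ! * (suc n ∸ k) !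
complement-factorials {n} {k} k≤n = begin
  suc (n ∸ k) ! * (n ∸ (n ∸ k)) !   ≡⟨ cong₂ (λ a b → a ! * b !) (sym (ℕ.+-∸-assoc 1 k≤n)) (ℕ.m∸[m∸n]≡n k≤n) ⟩
  (suc n ∸ k) ! * k !               ≡⟨ ℕ.*-comm ((suc n ∸ k) !) (k !) ⟩
  k ! * (suc n ∸ k) !               ∎
  where open ≡-Reasoning

count-sends-head : ∀ n (x : Subset n) y → ∣ y ∣ ≡ suc ∣ x ∣ → (L : Family (suc n)) → Distinct L →
                   All (λ σ → Sends σ (true ∷ x) y) L → length L ≤ suc ∣ x ∣ ! * (n ∸ ∣ x ∣) !

count-sends : ∀ n (x y : Subset n) → ∣ y ∣ ≡ ∣ x ∣ → (L : Family n) → Distinct L →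
              All (λ σ → Sends σ x y) L → length L ≤ ∣ x ∣ ! * (n ∸ ∣ x ∣) !
count-sends zero    []          [] _ []          _               _ = z≤n
count-sends zero    []          [] _ (_ ∷ [])    _               _ = ℕ.≤-refl
count-sends zero    []          [] _ (_ ∷ _ ∷ _) ((σ≉π ∷ _) ∷ _) _ = ⊥-elim (σ≉π (λ ()))
count-sends (suc n) (true  ∷ x) y ∣y∣≡ L dist sends = count-sends-head n x y ∣y∣≡ L dist sends
-- Passing to complements turns the head of x into true.
count-sends (suc n) (false ∷ x) y ∣y∣≡ L dist sends =
  subst (length L ≤_) (trans (cong (λ k → suc k ! * (n ∸ k) !) (∣∁p∣≡n∸∣p∣ x)) (complement-factorials (∣p∣≤n x)))
    (count-sends-head n (∁ x) (∁ y) ∣∁y∣≡ L dist (All.map (λ {σ} → Sends-∁ {σ = σ} {false ∷ x} {y}) sends))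
  where
  ∣∁y∣≡ : ∣ ∁ y ∣ ≡ suc ∣ ∁ x ∣
  ∣∁y∣≡ = begin
    ∣ ∁ y ∣          ≡⟨ ∣∁p∣≡n∸∣p∣ y ⟩
    suc n ∸ ∣ y ∣    ≡⟨ cong (suc n ∸_) ∣y∣≡ ⟩
    suc n ∸ ∣ x ∣    ≡⟨ ℕ.+-∸-assoc 1 (∣p∣≤n x) ⟩
    suc (n ∸ ∣ x ∣)  ≡⟨ cong suc (∣∁p∣≡n∸∣p∣ x) ⟨
    suc ∣ ∁ x ∣      ∎
    where open ≡-Reasoning

-- Split L by σ(0): the fibre over j ∈ y is counted by forgetting 0 ↦ j, the others are empty.
count-sends-head n x y ∣y∣≡ L dist sends =
  ℕ.≤-trans (length≤∑bounds label (λ j → if lookup y j then c else 0) L fibre≤) (ℕ.≤-reflexive ∑bounds≡)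
  where
  label : Perm (suc n) → Fin (suc n)
  label σ = σ ⟨$⟩ʳ zero
  c : ℕ
  c = ∣ x ∣ ! * (n ∸ ∣ x ∣) !

  module _ (j : Fin (suc n)) where
    F : Family (suc n)
    F = fibre label j L
    F-labels : All (λ σ → label σ ≡ j) F
    F-labels = All.all-filter (λ σ → label σ ≟ j) L
    F-sends : All (λ σ → Sends σ (true ∷ x) y) F
    F-sends = All.filter⁺ (λ σ → label σ ≟ j) sends

    fibre≤ : length F ≤ (if lookup y j then c else 0)
    fibre≤ with lookup y j in j∈y?
    ... | true  = subst (_≤ c) (length-map (remove zero) F)
      (count-sends n x (removeAt y j) (ℕ.suc-injective (trans (∣removeAt∣ y j j∈y?) ∣y∣≡))
        (map (remove zero) F) (distinct-removes j F F-labels (AllPairs.filter⁺ (λ σ → label σ ≟ j) dist))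
        (All.map⁺ (All.zipWith (λ {σ} (σ0≡j , s) → subst (λ k → Sends (remove zero σ) x (removeAt y k)) σ0≡j
                                                          (Sends-remove σ {true} {x} {y} s))
                               (F-labels , F-sends))))
    ... | false = empty F F-labels F-sends
      where
      empty : ∀ F → All (λ σ → label σ ≡ j) F → All (λ σ → Sends σ (true ∷ x) y) F → length F ≤ 0
      empty []      []          []         = z≤n
      empty (σ ∷ _) (σ0≡j ∷ _) (s ∷ _) = ⊥-elim (∉⇒¬∈ j∈y? (subst (λ k → lookup y k ≡ true) σ0≡j (Sends-head σ {true} {x} {y} s)))

  ∑bounds≡ : sum (λ j → if lookup y j then c else 0) ≡ suc ∣ x ∣ ! * (n ∸ ∣ x ∣) !
  ∑bounds≡ = trans (sum-select y c) (trans (cong (_* c) ∣y∣≡) (sym (ℕ.*-assoc (suc ∣ x ∣) (∣ x ∣ !) _)))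

∈⇒∈𝒜 : ∀ {n} {σ : Perm n} {𝒜 : Family n} → σ ∈ 𝒜 → σ ∈𝒜 𝒜
∈⇒∈𝒜 = Any.map (λ { refl _ → refl })

full-family⇒⊇stabilizer-coset :
  ∀ {n} (𝒜 : Family n) (x y : Subset n) → ∣ y ∣ ≡ ∣ x ∣ → Distinct 𝒜 →
  size 𝒜 ≡ ∣ x ∣ ! * (n ∸ ∣ x ∣) ! → (∀ σ → σ ∈𝒜 𝒜 → image σ x ≡ y) →
  ∀ σ → image σ x ≡ y → σ ∈𝒜 𝒜
full-family⇒⊇stabilizer-coset {n} 𝒜 x y ∣y∣≡∣x∣ dist size≡ all-send σ σx≡y
  with Any.any? (λ π → all? (λ i → σ ⟨$⟩ʳ i ≟ π ⟨$⟩ʳ i)) 𝒜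
... | yes σ∈𝒜 = σ∈𝒜
... | no  σ∉𝒜 = ⊥-elim (ℕ.<-irrefl size≡ (count-sends n x y ∣y∣≡∣x∣ (σ ∷ 𝒜)
                  (All.¬Any⇒All¬ 𝒜 σ∉𝒜 ∷ dist)
                  (image≡⇒Sends σ x σx≡y ∷ All.tabulate (λ {π} π∈ → image≡⇒Sends π x (all-send π (∈⇒∈𝒜 π∈))))))

module _ {m t} (𝒜 : Family (suc m)) (intersecting : SetIntersecting t 𝒜) (t≤n∸t : t ≤ suc m ∸ t)
         (C : Coset (suc m) t) (C⊆𝒜 : ∀ π → π ∈T C → π ∈𝒜 𝒜) {π₀ : Perm (suc m)} (π₀∈C : π₀ ∈T C) where

  open Coset C using (a; a-inj)

  coset⊆family⇒image≡ : ∀ σ → σ ∈𝒜 𝒜 → image σ (range a) ≡ image π₀ (range a)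
  coset⊆family⇒image≡ σ σ∈𝒜 = intersects-all-agreeing⇒image≡ (range a) (∣range∣ a a-inj) t≤n∸t σ π₀
    (λ π π≈π₀ → intersecting σ π σ∈𝒜 (C⊆𝒜 π (λ i → trans (π≈π₀ (a i) (∈-range a i)) (π₀∈C i))))

proposition2 : (t n : ℕ) → 1 ≤ t → n ≥ 2 * t → (𝒜 : Family n) →
    Distinct 𝒜 → SetIntersecting t 𝒜 → size 𝒜 ≡ (t !) * ((n ∸ t) !) →
    DisjointUnionOfCosets t 𝒜 → StabilizerCoset t 𝒜
proposition2 zero    _       ()  _ _ _ _ _ _
proposition2 (suc t) zero    _   () _ _ _ _ _
proposition2 t       (suc m) _   _ [] _ _ size≡ _ =
  ⊥-elim (ℕ.<⇒≢ (ℕ.*-mono-≤ (ℕ.1≤n! t) (ℕ.1≤n! (suc m ∸ t))) size≡)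
proposition2 t (suc m) _ n≥2t 𝒜@(π₀ ∷ _) dist intersecting size≡ (Cs , _ , ∈𝒜⇔∈⋃Cs)
  with C , C∈Cs , π₀∈C ← find (Equivalence.to (∈𝒜⇔∈⋃Cs π₀) (here (λ _ → refl))) =
  x , image π₀ x , ∣x∣≡t , trans (∣image∣ π₀ x) ∣x∣≡t , λ σ → mk⇔ (images≡ σ)
    (full-family⇒⊇stabilizer-coset 𝒜 x (image π₀ x) (∣image∣ π₀ x) dist
      (trans size≡ (cong (λ k → k ! * (suc m ∸ k) !) (sym ∣x∣≡t))) images≡ σ)
  where
  x : Subset (suc m)
  x = range (Coset.a C)
  ∣x∣≡t : ∣ x ∣ ≡ t
  ∣x∣≡t = ∣range∣ (Coset.a C) (Coset.a-inj C)
  t≤n∸t : t ≤ suc m ∸ t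
  t≤n∸t = ℕ.m+n≤o⇒m≤o∸n t (subst (λ k → t + k ≤ suc m) (ℕ.+-identityʳ t) n≥2t)
  C⊆𝒜 : ∀ π → π ∈T C → π ∈𝒜 𝒜
  C⊆𝒜 π π∈C = Equivalence.from (∈𝒜⇔∈⋃Cs π) (lose C∈Cs π∈C)
  images≡ : ∀ σ → σ ∈𝒜 𝒜 → image σ x ≡ image π₀ x
  images≡ = coset⊆family⇒image≡ 𝒜 intersecting t≤n∸t C C⊆𝒜 {π₀} π₀∈C
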